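{- Let $G$ be a finite simple graph with vertex set $\{1,\dots,n\}$ and let $t$ be an integer. Consider the $[t]$-system on $G$ under any fair update schedule. Then the state $x=(\mathrm{Deg}(1),\dots,\mathrm{Deg}(n))$ reaches a fixed point $C^t=(C_{1,t},\dots,C_{n,t})$, where (i) if $t>0$, then $C_{i,t}=0$ for all $1\le i\le n$; (ii) if $t\le 0$, then $C_{i,t}=C_t(i)$ for all $1\le i\le n$; in particular, if $t\le-\Delta(G)$, then $C_{i,t}=\mathrm{Deg}(i)$ for all $i$. In addition, the state $C^t$ reaches the fixed point $C^{t+1}$ in the $[t+1]$-system on $G$.
   Context: $\mathrm{Deg}(v)$ is the degree of $v$ in $G$ and $\Delta(G)=\max_v \mathrm{Deg}(v)$. The $[t]$-system on $G$: each vertex has a state in $\{0,1,\dots,n\}$; the local function $f_v$ at $v$ returns the maximum integer $k\ge 0$ such that at least $k$ neighbors of $v$ have state at least $k+t$. A fair update schedule is an infinite sequence $W_1W_2\cdots$ of vertex subsets such that every vertex lies in $W_l$ for infinitely many $l$; starting from $x^{(0)}$, $x^{(j)}$ is obtained from $x^{(j-1)}$ by letting each vertex $v\in W_j$ take the new state $f_v$ evaluated on the states in $x^{(j-1)}$, other vertices keeping their states. A state $x$ reaches a fixed point $z$ if from some time $k$ on, $x^{(j)}=z$ for all $j\ge k$. A D-chain of order $t$ of $G$ is a chain $G_0\ge G_1\ge\cdots\ge G_k$ of nonempty subgraphs with $G_0=G$, each $G_i$ a vertex-induced subgraph of $G_{i-1}$, such that for all $0\le i\le k$ every vertex of $G_i$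 has at least $i$ neighbors in $G_{\max\{0,i+t\}}$; $k$ is its length. It is maximal if (i) no D-chain of order $t$ is longer, and (ii) there is no D-chain $G'_0\ge\cdots\ge G'_k$ of order $t$ with $G_i$ a proper subgraph of $G'_i$ for some $1\le i\le k$. For $t\le 0$ the maximal D-chain of order $t$ exists and is unique; if $G_0\ge\cdots\ge G_k$ is it, the rank $C_t(v)$ of a vertex $v$ is the index $i$ such that $v\in G_i$ and $v\notin G_{i+1}$ (with $G_{k+1}$ taken to be empty). -}

module Defs where

open import Data.Nat as ℕ using (ℕ; zero; suc; _≤_; _<_; _≤ᵇ_; _⊔_)
open import Data.Integer as ℤ using (ℤ; +_)
open import Data.Fin using (Fin; zero; suc)
open import Data.Bool using (Bool; true; false; if_then_else_; _∧_)
open import Data.Product using (Σ; ∃; _×_; _,_; proj₁; proj₂)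
open import Relation.Binary.PropositionalEquality using (_≡_)
open import Relation.Nullary using (¬_)
open import Relation.Nullary.Decidable using (⌊_⌋)

record Graph (n : ℕ) : Set where
  field
    adj    : Fin n → Fin n → Bool
    sym    : ∀ u v → adj u v ≡ adj v u
    irrefl : ∀ v → adj v v ≡ false
open Graph public

count : ∀ {n} → (Fin n → Bool) → ℕ
count {zero}  p = 0
count {suc n} p = (if p zero then 1 else 0) ℕ.+ count (λ i → p (suc i))

maxF : ∀ {n} → (Fin n → ℕ) → ℕ
maxF {zero}  f = 0
maxF {suc n} f = f zero ⊔ maxF (λ i → f (suc i))

Deg : ∀ {n} → Graph n → Fin n → ℕ
Deg G v = count (adj G v)

Δ : ∀ {n} → Graph n → ℕ
Δ G = maxF (Deg G)

-- A vertex subset (vertex-induced subgraph is determined by it)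
VSet : ℕ → Set
VSet n = Fin n → Bool

nbrsIn : ∀ {n} → Graph n → Fin n → VSet n → ℕ
nbrsIn G v S = count (λ u → adj G v u ∧ S u)

State : ℕ → Set
State n = Fin n → ℕ

maxSat : (ℕ → Bool) → ℕ → ℕ
maxSat P zero    = 0
maxSat P (suc m) = if P (suc m) then suc m else maxSat P m

highNbrs : ∀ {n} → Graph n → ℤ → State n → Fin n → ℕ → ℕ
highNbrs G t x v k = count (λ u → adj G v u ∧ ⌊ (+ k) ℤ.+ t ℤ.≤? + (x u) ⌋)

-- local function of the [t]-system: max k ≥ 0 such that at least k
-- neighbours of v have state ≥ k + t.  (Such k is ≤ Deg v ≤ n, so
-- searching k ∈ {0,…,n} gives the maximum over all k ≥ 0.)
f : ∀ {n} → Graph n → ℤ → Fin n → State n → ℕ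
f {n} G t v x = maxSat (λ k → k ≤ᵇ highNbrs G t x v k) n

-- update schedule: W j is the set W_{j+1}
Schedule : ℕ → Set
Schedule n = ℕ → VSet n

Fair : ∀ {n} → Schedule n → Set
Fair {n} W = ∀ (v : Fin n) (m : ℕ) → ∃ λ l → m ≤ l × W l v ≡ true

step : ∀ {n} → Graph n → ℤ → VSet n → State n → State n
step G t Wj x v = if Wj v then f G t v x else x v

traj : ∀ {n} → Graph n → ℤ → Schedule n → State n → ℕ → State n
traj G t W x zero    = x
traj G t W x (suc j) = step G t (W j) (traj G t W x j)

IsFixedPoint : ∀ {n} → Graph n → ℤ → State n → Set
IsFixedPoint G t z = ∀ v → f G t v z ≡ z v

Reaches : ∀ {n} → Graph n → ℤ → Schedule n → State n → State n → Set
Reaches G t W x z = ∃ λ k → ∀ j → k ≤ j → ∀ v → traj G t W x j v ≡ z v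

clampIdx : ℕ → ℤ → ℕ
clampIdx i t = ℤ.∣ ((+ i) ℤ.+ t) ℤ.⊔ (+ 0) ∣

-- a chain G_0 ≥ … ≥ G_k of vertex-induced subgraphs: length k and vertex
-- sets S 0, …, S k (values of S beyond k are irrelevant)
Chain : ℕ → Set
Chain n = Σ ℕ (λ k → ℕ → VSet n)

len : ∀ {n} → Chain n → ℕ
len = proj₁

sets : ∀ {n} → Chain n → ℕ → VSet n
sets = proj₂

_⊆ˢ_ : ∀ {n} → VSet n → VSet n → Set
A ⊆ˢ B = ∀ v → A v ≡ true → B v ≡ true

_⊂ˢ_ : ∀ {n} → VSet n → VSet n → Set
A ⊂ˢ B = A ⊆ˢ B × ∃ λ v → B v ≡ true × A v ≡ false

IsDChain : ∀ {n} → Graph n → ℤ → Chain n → Set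
IsDChain {n} G t (k , S) =
    (∀ v → S 0 v ≡ true)
  × (∀ i → i ≤ k → ∃ λ v → S i v ≡ true)
  × (∀ i → i < k → S (suc i) ⊆ˢ S i)
  × (∀ i → i ≤ k → ∀ v → S i v ≡ true → i ≤ nbrsIn G v (S (clampIdx i t)))

IsMaximalDChain : ∀ {n} → Graph n → ℤ → Chain n → Set
IsMaximalDChain {n} G t ch =
    IsDChain G t ch
  × (∀ ch' → IsDChain G t ch' → len ch' ≤ len ch)
  × (∀ (S' : ℕ → VSet n) → IsDChain G t (len ch , S') →
       ¬ (∃ λ i → 1 ≤ i × i ≤ len ch × (sets ch i ⊂ˢ S' i)))

-- rank of v in the chain is i: v ∈ G_i and v ∉ G_{i+1} (G_{k+1} = ∅)
IsRank : ∀ {n} → Chain n → Fin n → ℕ → Set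
IsRank (k , S) v i = i ≤ k × S i v ≡ true × (suc i ≤ k → S (suc i) v ≡ false)

{-# OPTIONS --safe #-}
-- The local function f is monotone in the state.  Hence updating any set of
-- vertices in a state x with f(x) ≤ x (such as the degree vector) yields such a
-- state below x, and never drops below a state z with z ≤ f(z).  The total of
-- the states strictly decreases whenever a vertex that is not yet fixed is
-- updated, so fairness forces convergence, and the limit is the greatest fixed
-- point C^t whatever the schedule.  For t > 0 a positive value c at a fixed
-- point needs a neighbour of value ≥ c + t > c, so a common bound on all values
-- can be lowered down to 0.  For t ≤ 0 the rank function of a D-chain satisfies
-- z ≤ f(z), so it lies below C^t; conversely the level sets of C^t form a
-- D-chain, and maximality of the chain forces equality.  Finally f is antitone
-- in t, which lets C^t play the role of the degree vector for the [t+1]-system.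
module Submission where

open import Defs
open import Data.Nat using (ℕ)
open import Data.Integer using (ℤ; +_; _+_; _≤_; _<_; -_; 1ℤ)
open import Data.Fin using (Fin)
open import Data.Product using (Σ; _×_)
open import Relation.Binary.PropositionalEquality using (_≡_)

open import Data.Nat as ℕ using (zero; suc; z≤n; s≤s; _≤ᵇ_; _≤′_; ≤′-refl; ≤′-step)
  renaming (_≤_ to _≤ₙ_; _<_ to _<ₙ_; _≮_ to _≮ₙ_)
import Data.Nat.Properties as ℕ
import Data.Integer as ℤ
import Data.Integer.Properties as ℤ
open import Data.Fin using (zero; suc)
open import Data.Fin.Properties using (all?; ¬∀⟶∃¬)
open import Data.Bool using (Bool; true; false; _∧_)
open import Data.Bool.Properties using (∧-conicalˡ; ∧-conicalʳ; T-≡)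
open import Data.Empty using (⊥-elim)
open import Data.Product using (_,_; proj₁; proj₂; ∃)
open import Data.Sum using (_⊎_; inj₁; inj₂)
open import Function using (_∘_)
open import Function.Bundles using (Equivalence)
open import Relation.Nullary using (Dec; yes; no)
open import Relation.Nullary.Decidable using (⌊_⌋)
open import Relation.Binary.PropositionalEquality
  using (_≢_; refl; trans; cong₂; subst) renaming (sym to ≡-sym)

⌊⌋-true⇒ : ∀ {P : Set} (d : Dec P) → ⌊ d ⌋ ≡ true → P
⌊⌋-true⇒ (yes p) _ = p

⇒⌊⌋-true : ∀ {P : Set} (d : Dec P) → P → ⌊ d ⌋ ≡ true
⇒⌊⌋-true (yes _) _ = refl
⇒⌊⌋-true (no ¬p) p = ⊥-elim (¬p p)

≤ᵇ-true⇒ : ∀ m k → (m ≤ᵇ k) ≡ true → m ≤ₙ k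
≤ᵇ-true⇒ m k e = ℕ.≤ᵇ⇒≤ m k (Equivalence.from T-≡ e)

⇒≤ᵇ-true : ∀ {m k} → m ≤ₙ k → (m ≤ᵇ k) ≡ true
⇒≤ᵇ-true m≤k = Equivalence.to T-≡ (ℕ.≤⇒≤ᵇ m≤k)

count-mono : ∀ {m} (p q : Fin m → Bool) → (∀ u → p u ≡ true → q u ≡ true) →
             count p ≤ₙ count q
count-mono {zero}  p q p⊆q = z≤n
count-mono {suc m} p q p⊆q with p zero in p₀ | q zero in q₀
... | true  | true  = s≤s (count-mono _ _ (λ u → p⊆q (suc u)))
... | true  | false with () ← trans (≡-sym q₀) (p⊆q zero p₀)
... | false | true  = ℕ.m≤n⇒m≤1+n (count-mono _ _ (λ u → p⊆q (suc u)))
... | false | false = count-mono _ _ (λ u → p⊆q (suc u))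

count-∧-mono : ∀ {m} (a p q : Fin m → Bool) →
               (∀ u → a u ≡ true → p u ≡ true → q u ≡ true) →
               count (λ u → a u ∧ p u) ≤ₙ count (λ u → a u ∧ q u)
count-∧-mono a p q p⊆q = count-mono _ _ λ u e →
  let aᵤ = ∧-conicalˡ (a u) (p u) e
  in cong₂ _∧_ aᵤ (p⊆q u aᵤ (∧-conicalʳ (a u) (p u) e))

count≤ : ∀ {m} (p : Fin m → Bool) → count p ≤ₙ m
count≤ {zero}  p = z≤n
count≤ {suc m} p with p zero
... | true  = s≤s (count≤ _)
... | false = ℕ.m≤n⇒m≤1+n (count≤ _)

count>0⇒∃ : ∀ {m} (p : Fin m → Bool) → 0 <ₙ count p → ∃ λ u → p u ≡ true
count>0⇒∃ {suc m} p pos with p zero in p₀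
... | true  = zero , p₀
... | false = let u , pᵤ = count>0⇒∃ (λ i → p (suc i)) pos in suc u , pᵤ

≤maxF : ∀ {m} (g : Fin m → ℕ) v → g v ≤ₙ maxF g
≤maxF g zero    = ℕ.m≤m⊔n _ _
≤maxF g (suc v) = ℕ.≤-trans (≤maxF (λ i → g (suc i)) v) (ℕ.m≤n⊔m _ _)

maxSat≤ : ∀ P m → maxSat P m ≤ₙ m
maxSat≤ P zero    = z≤n
maxSat≤ P (suc m) with P (suc m)
... | true  = ℕ.≤-refl
... | false = ℕ.m≤n⇒m≤1+n (maxSat≤ P m)

≤maxSat : ∀ P m {k} → P k ≡ true → k ≤ₙ m → k ≤ₙ maxSat P m
≤maxSat P zero    _  z≤n = z≤n
≤maxSat P (suc m) Pk k≤1+m with P (suc m) in P₁₊ₘ | ℕ.m≤n⇒m<n∨m≡n k≤1+m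
... | true  | _          = k≤1+m
... | false | inj₁ k<1+m = ≤maxSat P m Pk (ℕ.≤-pred k<1+m)
... | false | inj₂ refl with () ← trans (≡-sym P₁₊ₘ) Pk

maxSat-satisfies : ∀ P m → maxSat P m ≡ 0 ⊎ P (maxSat P m) ≡ true
maxSat-satisfies P zero    = inj₁ refl
maxSat-satisfies P (suc m) with P (suc m) in P₁₊ₘ
... | true  = inj₂ P₁₊ₘ
... | false = maxSat-satisfies P m

maxSat-mono : ∀ P Q m → (∀ k → P k ≡ true → Q k ≡ true) → maxSat P m ≤ₙ maxSat Q m
maxSat-mono P Q m P⊆Q with maxSat-satisfies P m
... | inj₁ ≡0 = subst (_≤ₙ maxSat Q m) (≡-sym ≡0) z≤n
... | inj₂ Pk = ≤maxSat Q m (P⊆Q _ Pk) (maxSat≤ P m)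

total : ∀ {m} → (Fin m → ℕ) → ℕ
total {zero}  x = 0
total {suc m} x = x zero ℕ.+ total (λ i → x (suc i))

total-mono : ∀ {m} (x y : Fin m → ℕ) → (∀ v → x v ≤ₙ y v) → total x ≤ₙ total y
total-mono {zero}  x y x≤y = z≤n
total-mono {suc m} x y x≤y = ℕ.+-mono-≤ (x≤y zero) (total-mono _ _ (λ v → x≤y (suc v)))

total-mono-< : ∀ {m} (x y : Fin m → ℕ) → (∀ v → x v ≤ₙ y v) →
               ∀ w → x w <ₙ y w → total x <ₙ total y
total-mono-< x y x≤y zero    x<y =
  ℕ.+-mono-<-≤ x<y (total-mono _ _ (λ v → x≤y (suc v)))
total-mono-< x y x≤y (suc w) x<y =
  ℕ.+-mono-≤-< (x≤y zero) (total-mono-< _ _ (λ v → x≤y (suc v)) w x<y)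

+clampIdx≡i+t⊔0 : ∀ i t → + clampIdx i t ≡ (+ i + t) ℤ.⊔ + 0
+clampIdx≡i+t⊔0 i t = ℤ.0≤i⇒+∣i∣≡i (ℤ.i≤j⊔i (+ i + t) (+ 0))

i+t≤x⇒clampIdx≤x : ∀ i t x → + i + t ≤ + x → clampIdx i t ≤ₙ x
i+t≤x⇒clampIdx≤x i t x i+t≤x = ℤ.drop‿+≤+
  (subst (_≤ + x) (≡-sym (+clampIdx≡i+t⊔0 i t)) (ℤ.⊔-lub i+t≤x (ℤ.+≤+ z≤n)))

clampIdx≤x⇒i+t≤x : ∀ i t x → clampIdx i t ≤ₙ x → + i + t ≤ + x
clampIdx≤x⇒i+t≤x i t x clamp≤x = ℤ.≤-trans (ℤ.i≤i⊔j (+ i + t) (+ 0))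
  (subst (_≤ + x) (+clampIdx≡i+t⊔0 i t) (ℤ.+≤+ clamp≤x))

clampIdx≤i : ∀ i {t} → t ≤ + 0 → clampIdx i t ≤ₙ i
clampIdx≤i i {t} t≤0 = i+t≤x⇒clampIdx≤x i t i
  (subst (+ i + t ≤_) (ℤ.+-identityʳ (+ i)) (ℤ.+-monoʳ-≤ (+ i) t≤0))

module LocalFunction {n : ℕ} (G : Graph n) where

  high? : ℤ → State n → ℕ → Fin n → Bool
  high? t x k u = ⌊ + k + t ℤ.≤? + x u ⌋

  highNbrs-mono : ∀ {x y} v t k s l → (∀ u → + k + t ≤ + x u → + l + s ≤ + y u) →
                  highNbrs G t x v k ≤ₙ highNbrs G s y v l
  highNbrs-mono {x} {y} v t k s l high⇒high =
    count-∧-mono (adj G v) (high? t x k) (high? s y l) λ u _ e →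
      ⇒⌊⌋-true (+ l + s ℤ.≤? + y u) (high⇒high u (⌊⌋-true⇒ (+ k + t ℤ.≤? + x u) e))

  f≤highNbrs : ∀ t v x → f G t v x ≤ₙ highNbrs G t x v (f G t v x)
  f≤highNbrs t v x with maxSat-satisfies (λ k → k ≤ᵇ highNbrs G t x v k) n
  ... | inj₁ ≡0 = subst (_≤ₙ highNbrs G t x v (f G t v x)) (≡-sym ≡0) z≤n
  ... | inj₂ e  = ≤ᵇ-true⇒ _ _ e

  ≤f : ∀ t v x {k} → k ≤ₙ n → k ≤ₙ highNbrs G t x v k → k ≤ₙ f G t v x
  ≤f t v x k≤n k≤high = ≤maxSat _ n (⇒≤ᵇ-true k≤high) k≤n

  fixedPoint≤highNbrs : ∀ t {z} → IsFixedPoint G t z → ∀ v → z v ≤ₙ highNbrs G t z v (z v)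
  fixedPoint≤highNbrs t {z} fixed v =
    subst (λ c → c ≤ₙ highNbrs G t z v c) (fixed v) (f≤highNbrs t v z)

  f≤n : ∀ t v x → f G t v x ≤ₙ n
  f≤n t v x = maxSat≤ _ n

  f≤Deg : ∀ t v x → f G t v x ≤ₙ Deg G v
  f≤Deg t v x = ℕ.≤-trans (f≤highNbrs t v x)
    (count-mono _ (adj G v) (λ u e → ∧-conicalˡ (adj G v u) _ e))

  f-mono : ∀ t v {x y} → (∀ u → x u ≤ₙ y u) → f G t v x ≤ₙ f G t v y
  f-mono t v x≤y = maxSat-mono _ _ n λ k e → ⇒≤ᵇ-true (ℕ.≤-trans (≤ᵇ-true⇒ k _ e)
    (highNbrs-mono v t k t k (λ u k+t≤x → ℤ.≤-trans k+t≤x (ℤ.+≤+ (x≤y u)))))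

  f-antitone-t : ∀ t v x → f G (t + 1ℤ) v x ≤ₙ f G t v x
  f-antitone-t t v x = maxSat-mono _ _ n λ k e → ⇒≤ᵇ-true (ℕ.≤-trans (≤ᵇ-true⇒ k _ e)
    (highNbrs-mono v (t + 1ℤ) k t k (λ _ → ℤ.≤-trans (ℤ.+-monoʳ-≤ (+ k) (ℤ.i≤i+j t 1ℤ)))))

fixedPoint-vanishes : ∀ {n} (G : Graph n) {t z} → + 0 < t → IsFixedPoint G t z → ∀ v → z v ≡ 0
fixedPoint-vanishes G {+ zero} (ℤ.+<+ ())
fixedPoint-vanishes {n} G {+ suc m} {z} _ fixed =
  vanishes-below n (λ u → subst (_≤ₙ n) (fixed u) (f≤n (+ suc m) u z))
  where
    open LocalFunction G

    high-bound-pred : ∀ {b} → (∀ u → z u ≤ₙ suc b) → ∀ v c →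
                      c ≤ₙ highNbrs G (+ suc m) z v c → c ≤ₙ b
    high-bound-pred z≤1+b v zero    _        = z≤n
    high-bound-pred z≤1+b v (suc c) c≤high =
      let u , uᵥ = count>0⇒∃ _ (ℕ.≤-trans (s≤s z≤n) c≤high)
          c+t≤zᵤ = ⌊⌋-true⇒ (+ suc c + + suc m ℤ.≤? + z u) (∧-conicalʳ (adj G v u) _ uᵥ)
      in ℕ.≤-pred (ℕ.<-≤-trans (ℕ.m<m+n (suc c) (s≤s z≤n))
                     (ℕ.≤-trans (ℤ.drop‿+≤+ c+t≤zᵤ) (z≤1+b u)))

    vanishes-below : ∀ b → (∀ u → z u ≤ₙ b) → ∀ v → z v ≡ 0
    vanishes-below zero    z≤0   v = ℕ.n≤0⇒n≡0 (z≤0 v)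
    vanishes-below (suc b) z≤1+b   = vanishes-below b λ v →
      high-bound-pred z≤1+b v (z v) (fixedPoint≤highNbrs (+ suc m) fixed v)

rankIn : ∀ {n} → Chain n → State n
rankIn (k , S) w = maxSat (λ i → S i w) k

levels : ∀ {n} → State n → ℕ → VSet n
levels z i w = i ≤ᵇ z w

module Dynamics {n : ℕ} (G : Graph n) (t : ℤ) where
  open LocalFunction G

  _≤ₛ_ : State n → State n → Set
  x ≤ₛ y = ∀ v → x v ≤ₙ y v

  IsPrefixedPoint : State n → Set
  IsPrefixedPoint x = ∀ v → f G t v x ≤ₙ x v

  IsPostfixedPoint : State n → Set
  IsPostfixedPoint z = ∀ v → z v ≤ₙ f G t v z

  fixed⇒postfixed : ∀ {z} → IsFixedPoint G t z → IsPostfixedPoint z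
  fixed⇒postfixed fixed v = ℕ.≤-reflexive (≡-sym (fixed v))

  step-updates : ∀ W x {v} → W v ≡ true → step G t W x v ≡ f G t v x
  step-updates W x v∈W rewrite v∈W = refl

  step-≤ : ∀ W {x} → IsPrefixedPoint x → step G t W x ≤ₛ x
  step-≤ W x-pre v with W v
  ... | true  = x-pre v
  ... | false = ℕ.≤-refl

  step-prefixed : ∀ W {x} → IsPrefixedPoint x → IsPrefixedPoint (step G t W x)
  step-prefixed W {x} x-pre v with W v
  ... | true  = f-mono t v (step-≤ W x-pre)
  ... | false = ℕ.≤-trans (f-mono t v (step-≤ W x-pre)) (x-pre v)

  step-above : ∀ W {x z} → IsPostfixedPoint z → z ≤ₛ x → z ≤ₛ step G t W x
  step-above W z-post z≤x v with W v
  ... | true  = ℕ.≤-trans (z-post v) (f-mono t v z≤x)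
  ... | false = z≤x v

  module Trajectory (W : Schedule n) (x₀ : State n) (x₀-pre : IsPrefixedPoint x₀) where

    x : ℕ → State n
    x = traj G t W x₀

    prefixed : ∀ j → IsPrefixedPoint (x j)
    prefixed zero    = x₀-pre
    prefixed (suc j) = step-prefixed (W j) (prefixed j)

    antitone : ∀ {i j} → i ≤ₙ j → x j ≤ₛ x i
    antitone = go ∘ ℕ.≤⇒≤′
      where
        go : ∀ {i j} → i ≤′ j → x j ≤ₛ x i
        go ≤′-refl            v = ℕ.≤-refl
        go (≤′-step {j} i≤′j) v = ℕ.≤-trans (step-≤ (W j) (prefixed j) v) (go i≤′j v)

    above : ∀ {z} → IsPostfixedPoint z → ∀ {i} → z ≤ₛ x i → ∀ {j} → i ≤ₙ j → z ≤ₛ x j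
    above {z} z-post {i} z≤xᵢ = go ∘ ℕ.≤⇒≤′
      where
        go : ∀ {j} → i ≤′ j → z ≤ₛ x j
        go ≤′-refl            = z≤xᵢ
        go (≤′-step {j} i≤′j) = step-above (W j) z-post (go i≤′j)

    stable : ∀ {k} → IsFixedPoint G t (x k) → ∀ {j} → k ≤ₙ j → ∀ v → x j v ≡ x k v
    stable xₖ-fixed k≤j v =
      ℕ.≤-antisym (antitone k≤j v) (above (fixed⇒postfixed xₖ-fixed) (λ _ → ℕ.≤-refl) k≤j v)

    module _ (fair : Fair W) where

      total-decreases : ∀ {j v} → f G t v (x j) ≢ x j v → ∀ {l} → j ≤ₙ l → W l v ≡ true →
                        total (x (suc l)) <ₙ total (x j)
      total-decreases {j} {v} fv≢xv {l} j≤l v∈Wₗ =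
        total-mono-< (x (suc l)) (x j) (antitone (ℕ.m≤n⇒m≤1+n j≤l)) v
          (subst (_<ₙ x j v) (≡-sym (step-updates (W l) (x l) v∈Wₗ))
            (ℕ.≤-<-trans (f-mono t v (antitone j≤l)) (ℕ.≤∧≢⇒< (prefixed j v) fv≢xv)))

      converges-within : ∀ s j → total (x j) <ₙ s → ∃ λ k → IsFixedPoint G t (x k)
      converges-within (suc s) j total<1+s with all? (λ v → f G t v (x j) ℕ.≟ x j v)
      ... | yes fixed = j , fixed
      ... | no ¬fixed =
        let v , fv≢xv = ¬∀⟶∃¬ n _ (λ v → f G t v (x j) ℕ.≟ x j v) ¬fixed
            l , j≤l , v∈Wₗ = fair v j
        in converges-within s (suc l)
             (ℕ.<-≤-trans (total-decreases fv≢xv j≤l v∈Wₗ) (ℕ.≤-pred total<1+s))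

      converges : ∃ λ k → IsFixedPoint G t (x k)
      converges = converges-within (suc (total x₀)) 0 (ℕ.n<1+n _)

      reaches-greatest : ∀ {z} → IsFixedPoint G t z → z ≤ₛ x₀ →
                         (∀ y → IsFixedPoint G t y → y ≤ₛ x₀ → y ≤ₛ z) → Reaches G t W x₀ z
      reaches-greatest z-fixed z≤x₀ greatest =
        let k , xₖ-fixed = converges
        in k , λ j k≤j v → trans (stable xₖ-fixed k≤j v)
                 (ℕ.≤-antisym (greatest (x k) xₖ-fixed (antitone (z≤n {k})) v)
                              (above (fixed⇒postfixed z-fixed) z≤x₀ (z≤n {k}) v))

  synchronous : Schedule n
  synchronous _ _ = true

  synchronous-fair : Fair synchronous
  synchronous-fair v m = m , ℕ.≤-refl , refl

  Deg-prefixed : IsPrefixedPoint (Deg G)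
  Deg-prefixed v = f≤Deg t v (Deg G)

  module Synchronous = Trajectory synchronous (Deg G) Deg-prefixed

  synchronous-limit : ∃ λ k → IsFixedPoint G t (Synchronous.x k)
  synchronous-limit = Synchronous.converges synchronous-fair

  C : State n
  C = Synchronous.x (proj₁ synchronous-limit)

  C-fixed : IsFixedPoint G t C
  C-fixed = proj₂ synchronous-limit

  postfixed≤Deg : ∀ {z} → IsPostfixedPoint z → z ≤ₛ Deg G
  postfixed≤Deg {z} z-post v = ℕ.≤-trans (z-post v) (f≤Deg t v z)

  postfixed≤C : ∀ {z} → IsPostfixedPoint z → z ≤ₛ C
  postfixed≤C z-post =
    Synchronous.above z-post (postfixed≤Deg z-post) (z≤n {proj₁ synchronous-limit})

  Deg-reaches-C : ∀ W → Fair W → Reaches G t W (Deg G) C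
  Deg-reaches-C W fair = Trajectory.reaches-greatest W (Deg G) Deg-prefixed fair C-fixed
    (postfixed≤Deg (fixed⇒postfixed C-fixed)) (λ y y-fixed _ → postfixed≤C (fixed⇒postfixed y-fixed))

  Deg-postfixed : t ≤ - (+ Δ G) → IsPostfixedPoint (Deg G)
  Deg-postfixed t≤-Δ v = ≤f t v (Deg G) (count≤ _)
    (count-mono (adj G v) _ λ u e → cong₂ _∧_ e (⇒⌊⌋-true (_ ℤ.≤? _) (deg-high u)))
    where
      deg-high : ∀ u → + Deg G v + t ≤ + Deg G u
      deg-high u = ℤ.≤-trans (ℤ.+-monoʳ-≤ (+ Deg G v) t≤-Δ)
        (ℤ.≤-trans (ℤ.i≤j⇒i-j≤0 (ℤ.+≤+ (≤maxF (Deg G) v))) (ℤ.+≤+ z≤n))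

  C≡Deg : t ≤ - (+ Δ G) → ∀ v → C v ≡ Deg G v
  C≡Deg t≤-Δ v = ℕ.≤-antisym (subst (_≤ₙ Deg G v) (C-fixed v) (f≤Deg t v C))
                              (postfixed≤C (Deg-postfixed t≤-Δ) v)

  rankIn-postfixed : t ≤ + 0 → ∀ ch → IsDChain G t ch → IsPostfixedPoint (rankIn ch)
  rankIn-postfixed t≤0 (k , S) (_ , _ , _ , degree) w
    with maxSat-satisfies (λ i → S i w) k
  ... | inj₁ ≡0  = subst (_≤ₙ f G t w (rankIn (k , S))) (≡-sym ≡0) z≤n
  ... | inj₂ w∈S = ≤f t w z (ℕ.≤-trans i≤nbrs (count≤ _)) (ℕ.≤-trans i≤nbrs nbrs≤high)
    where
      z : State n
      z = rankIn (k , S)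
      i : ℕ
      i = z w
      i≤k : i ≤ₙ k
      i≤k = maxSat≤ (λ j → S j w) k
      i≤nbrs : i ≤ₙ nbrsIn G w (S (clampIdx i t))
      i≤nbrs = degree i i≤k w w∈S
      nbrs≤high : nbrsIn G w (S (clampIdx i t)) ≤ₙ highNbrs G t z w i
      nbrs≤high = count-∧-mono (adj G w) _ _ λ u _ u∈S → ⇒⌊⌋-true (_ ℤ.≤? _)
        (clampIdx≤x⇒i+t≤x i t (z u)
          (≤maxSat _ k u∈S (ℕ.≤-trans (clampIdx≤i i t≤0) i≤k)))

  levels-isDChain : ∀ {z} → IsFixedPoint G t z → ∀ {L} w₀ → L ≤ₙ z w₀ →
                    IsDChain G t (L , levels z)
  levels-isDChain {z} fixed {L} w₀ L≤z =
      (λ _ → refl)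
    , (λ i i≤L → w₀ , ⇒≤ᵇ-true (ℕ.≤-trans i≤L L≤z))
    , (λ i _ w i+1≤z → ⇒≤ᵇ-true (ℕ.≤-trans (ℕ.n≤1+n i) (≤ᵇ-true⇒ _ _ i+1≤z)))
    , degree
    where
      degree : ∀ i → i ≤ₙ L → ∀ w → levels z i w ≡ true → i ≤ₙ nbrsIn G w (levels z (clampIdx i t))
      degree i _ w i∈levels = begin
        i                                       ≤⟨ i≤zᵂ ⟩
        z w                                     ≤⟨ fixedPoint≤highNbrs t fixed w ⟩
        highNbrs G t z w (z w)                  ≤⟨ count-∧-mono (adj G w) _ _ high⇒level ⟩
        nbrsIn G w (levels z (clampIdx i t))    ∎
        where
          open ℕ.≤-Reasoning
          i≤zᵂ : i ≤ₙ z w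
          i≤zᵂ = ≤ᵇ-true⇒ _ _ i∈levels
          high⇒level : ∀ u → adj G w u ≡ true → high? t z (z w) u ≡ true → levels z (clampIdx i t) u ≡ true
          high⇒level u _ high = ⇒≤ᵇ-true (i+t≤x⇒clampIdx≤x i t (z u)
            (ℤ.≤-trans (ℤ.+-monoˡ-≤ t (ℤ.+≤+ i≤zᵂ)) (⌊⌋-true⇒ (_ ℤ.≤? _) high)))

  -- If C exceeded the rank r of v, the level sets of C would properly enlarge
  -- the (r+1)-th set of the maximal chain.
  C≡rank : t ≤ + 0 → ∀ ch → IsMaximalDChain G t ch → ∀ v r → IsRank ch v r → C v ≡ r
  C≡rank t≤0 ch@(k , S) (isDChain@(_ , nonempty , _ , _) , longest , unrefinable) v r
         (r≤k , v∈Sᵣ , v∉S₁₊ᵣ) = ℕ.≤-antisym (ℕ.≮⇒≥ r≮Cᵥ) (rank≤C v∈Sᵣ r≤k)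
    where
      rank≤C : ∀ {w i} → S i w ≡ true → i ≤ₙ k → i ≤ₙ C w
      rank≤C w∈Sᵢ i≤k = ℕ.≤-trans (≤maxSat _ k w∈Sᵢ i≤k)
                                   (postfixed≤C (rankIn-postfixed t≤0 ch isDChain) _)

      w₀ : Fin n
      w₀ = proj₁ (nonempty k ℕ.≤-refl)

      levels-long : IsDChain G t (k , levels C)
      levels-long = levels-isDChain C-fixed w₀ (rank≤C (proj₂ (nonempty k ℕ.≤-refl)) ℕ.≤-refl)

      r≮Cᵥ : r ≮ₙ C v
      r≮Cᵥ r<Cᵥ = unrefinable (levels C) levels-long
        (suc r , s≤s z≤n , r+1≤k , (λ w w∈S₁₊ᵣ → ⇒≤ᵇ-true (rank≤C w∈S₁₊ᵣ r+1≤k))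
                                  , v , ⇒≤ᵇ-true r<Cᵥ , v∉S₁₊ᵣ r+1≤k)
        where
          r+1≤k : suc r ≤ₙ k
          r+1≤k = ℕ.≤-trans r<Cᵥ (longest (C v , levels C) (levels-isDChain C-fixed v ℕ.≤-refl))

C-reaches-next : ∀ {n} (G : Graph n) t W → Fair W →
                 Reaches G (t + 1ℤ) W (Dynamics.C G t) (Dynamics.C G (t + 1ℤ))
C-reaches-next G t W fair =
  Next.Trajectory.reaches-greatest W C C-prefixed-next fair Next.C-fixed
    (postfixed≤C next-postfixed) (λ y y-fixed _ → Next.postfixed≤C (Next.fixed⇒postfixed y-fixed))
  where
    open Dynamics G t
    module Next = Dynamics G (t + 1ℤ)
    open LocalFunction G

    C-prefixed-next : Next.IsPrefixedPoint C
    C-prefixed-next v = ℕ.≤-trans (f-antitone-t t v C) (ℕ.≤-reflexive (C-fixed v))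

    next-postfixed : IsPostfixedPoint Next.C
    next-postfixed v = ℕ.≤-trans (Next.fixed⇒postfixed Next.C-fixed v) (f-antitone-t t v Next.C)

theorem3 : ∀ (n : ℕ) (G : Graph n) →
    Σ (ℤ → State n) λ C → ∀ (t : ℤ) →
        IsFixedPoint G t (C t)
      × (∀ W → Fair W → Reaches G t W (Deg G) (C t))
      × (+ 0 < t → ∀ i → C t i ≡ 0)
      × (t ≤ + 0 → ∀ ch → IsMaximalDChain G t ch → ∀ v r → IsRank ch v r → C t v ≡ r)
      × (t ≤ - (+ Δ G) → ∀ i → C t i ≡ Deg G i)
      × (∀ W → Fair W → Reaches G (t + 1ℤ) W (C t) (C (t + 1ℤ)))
theorem3 n G = Dynamics.C G , λ t →
  let open Dynamics G t
  in C-fixed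
   , Deg-reaches-C
   , (λ t>0 → fixedPoint-vanishes G t>0 C-fixed)
   , C≡rank
   , C≡Deg
   , C-reaches-next G t
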